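{- Let $m,n\ge 1$ and let $G=K_{m,n}\setminus M$, where $M$ is a matching of size $t$ in $K_{m,n}$. Then $\operatorname{fp}(G)=1$ if $t\le 1$, and $\operatorname{fp}(G)=2$ if $t\ge 2$.
   Context: A bipartite graph is a Ferrers graph if it contains no induced copy of $2K_2$ (two disjoint edges with no other edges among their four endpoints); equivalently, the neighborhoods on one side are totally ordered by inclusion. For a bipartite graph $G=(U,V,E)$, $\operatorname{fp}(G)$ is the minimum $k$ such that $E$ can be partitioned into $k$ sets $E_i$ with each spanning subgraph $(U,V,E_i)$ a Ferrers graph. $K_{m,n}\setminus M$ is the complete bipartite graph with the edges of $M$ deleted, keeping the same bipartition. -}

module Defs where

open import Level using (0ℓ)
open import Data.Nat using (ℕ; _≤_)
open import Data.Fin using (Fin)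
open import Data.Product using (Σ; ∃; _×_)
open import Data.Sum using (_⊎_)
open import Relation.Nullary using (¬_)
open import Relation.Binary.PropositionalEquality using (_≡_)
open import Function.Definitions using (Injective)

BipGraph : ℕ → ℕ → Set₁
BipGraph m n = Fin m → Fin n → Set

-- Ferrers graph: no induced 2K₂, i.e. for any two disjoint edges u₁v₁, u₂v₂
-- at least one of the cross pairs u₁v₂, u₂v₁ is also an edge.
IsFerrers : ∀ {m n} → BipGraph m n → Set
IsFerrers {m} {n} E =
  ∀ (u₁ u₂ : Fin m) (v₁ v₂ : Fin n) → E u₁ v₁ → E u₂ v₂ →
  ¬ (u₁ ≡ u₂) → ¬ (v₁ ≡ v₂) → E u₁ v₂ ⊎ E u₂ v₁

Part : ∀ {m n k} (E : BipGraph m n) → (∀ u v → E u v → Fin k) → Fin k → BipGraph m n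
Part E c i u v = Σ (E u v) λ e → c u v e ≡ i

HasFerrersPartition : ∀ {m n} → ℕ → BipGraph m n → Set
HasFerrersPartition {m} {n} k E =
  Σ (∀ (u : Fin m) (v : Fin n) → E u v → Fin k) λ c → ∀ i → IsFerrers (Part E c i)

FpIs : ∀ {m n} → BipGraph m n → ℕ → Set
FpIs E k = (1 ≤ k) × HasFerrersPartition k E × (∀ j → 1 ≤ j → HasFerrersPartition j E → k ≤ j)

-- A matching of size t in K_{m,n}: edges (f i, g i), i < t, with f and g injective.
-- K_{m,n} \ M:
KminusM : ∀ {m n t} → (Fin t → Fin m) → (Fin t → Fin n) → BipGraph m n
KminusM {t = t} f g u v = ¬ (∃ λ (i : Fin t) → f i ≡ u × g i ≡ v)

{-# OPTIONS --safe #-}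
-- Rank the vertices along the matching: the i-th matched vertex gets rank i+1 on
-- both sides, unmatched vertices of U get rank 0 and unmatched vertices of V get
-- rank t+1.  Then uv is an edge of K_{m,n} \ M exactly when the ranks of u and v
-- differ, so the edges split into the pairs with rank u < rank v and those with
-- rank u > rank v, and each comparison graph is Ferrers.  For t ≤ 1 the graph is
-- already Ferrers, while two matching edges i ≠ j make (f i)(g j), (f j)(g i) an
-- induced 2K₂.
module Submission where

open import Defs
open import Level using (0ℓ)
open import Data.Nat using (ℕ; zero; suc; _≤_; _<_; _<?_; z≤n; s≤s)
open import Data.Nat.Properties
  using (<-strictTotalOrder; <⇒≢; <⇒≯; ≮⇒≥; ≤∧≢⇒<; 0≢1+n; suc-injective; ≤-refl)
open import Data.Fin using (Fin; toℕ)
open import Data.Fin.Properties using (any?; toℕ-injective; toℕ<n) renaming (_≟_ to _≟ᶠ_)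
open import Data.Product using (_×_; _,_; ∃; proj₁; proj₂; swap)
open import Data.Sum using (_⊎_; inj₁; inj₂) renaming (map to ⊎-map)
open import Function using (_∘_)
open import Function.Definitions using (Injective)
open import Relation.Nullary using (¬_; Dec; yes; no; contradiction)
open import Relation.Nullary.Decidable using (_×-dec_)
open import Relation.Binary.Core using (_⇔_)
open import Relation.Binary.Bundles using (StrictTotalOrder)
open import Relation.Binary.Definitions using (Decidable; tri<; tri≈; tri>)
open import Relation.Binary.Construct.Intersection using (_∩_)
import Relation.Binary.Construct.Flip.EqAndOrd as Flip
open import Relation.Binary.PropositionalEquality
  using (_≡_; _≢_; ≢-sym; refl; sym; trans; cong; subst)

Fin≤1-unique : ∀ {t} → t ≤ 1 → (i j : Fin t) → i ≡ j
Fin≤1-unique (s≤s z≤n) Fin.zero Fin.zero = refl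

module _ (O : StrictTotalOrder 0ℓ 0ℓ 0ℓ) where
  open StrictTotalOrder O
    using (Carrier; compare; <-respʳ-≈; module Eq) renaming (_<_ to _⊏_; trans to ⊏-trans)

  comparison-isFerrers : ∀ {m n} (r : Fin m → Carrier) (s : Fin n → Carrier) →
    IsFerrers (λ u v → r u ⊏ s v)
  comparison-isFerrers r s u₁ u₂ v₁ v₂ r₁<s₁ r₂<s₂ _ _ with compare (r u₁) (s v₂)
  ... | tri< r₁<s₂ _ _ = inj₁ r₁<s₂
  ... | tri≈ _ r₁≈s₂ _ = inj₂ (⊏-trans (<-respʳ-≈ (Eq.sym r₁≈s₂) r₂<s₂) r₁<s₁)
  ... | tri> _ _ s₂<r₁ = inj₂ (⊏-trans (⊏-trans r₂<s₂ s₂<r₁) r₁<s₁)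

module _ {m n : ℕ} where

  IsFerrers-resp : {A B : BipGraph m n} → A ⇔ B → IsFerrers A → IsFerrers B
  IsFerrers-resp (A⇒B , B⇒A) ferrers u₁ u₂ v₁ v₂ e₁ e₂ u₁≢u₂ v₁≢v₂ =
    ⊎-map A⇒B A⇒B (ferrers u₁ u₂ v₁ v₂ (B⇒A e₁) (B⇒A e₂) u₁≢u₂ v₁≢v₂)

  Part-Fin1 : {E : BipGraph m n} (c : ∀ u v → E u v → Fin 1) → Part E c Fin.zero ⇔ E
  Part-Fin1 c = proj₁ , λ e → e , Fin≤1-unique ≤-refl _ _

  isFerrers⇒FpIs1 : {E : BipGraph m n} → IsFerrers E → FpIs E 1
  isFerrers⇒FpIs1 {E} ferrers =
    ≤-refl , (colouring , ferrersClass) , λ _ 1≤j _ → 1≤j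
    where
    colouring : ∀ u v → E u v → Fin 1
    colouring _ _ _ = Fin.zero

    ferrersClass : ∀ i → IsFerrers (Part E colouring i)
    ferrersClass Fin.zero = IsFerrers-resp (swap (Part-Fin1 colouring)) ferrers

  nonFerrers⇒FpIs2 : {E : BipGraph m n} →
    HasFerrersPartition 2 E → ¬ IsFerrers E → FpIs E 2
  nonFerrers⇒FpIs2 {E} partition ¬ferrers = s≤s z≤n , partition , atLeastTwo
    where
    atLeastTwo : ∀ j → 1 ≤ j → HasFerrersPartition j E → 2 ≤ j
    atLeastTwo (suc zero)    _ (c , ferrers) =
      contradiction (IsFerrers-resp (Part-Fin1 c) (ferrers Fin.zero)) ¬ferrers
    atLeastTwo (suc (suc _)) _ _ = s≤s (s≤s z≤n)

  twoFerrersClasses : {E P : BipGraph m n} → Decidable P →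
    IsFerrers (E ∩ P) → IsFerrers (E ∩ (λ u v → ¬ P u v)) → HasFerrersPartition 2 E
  twoFerrersClasses {E} {P} P? ferrersP ferrers¬P = colouring , ferrersClass
    where
    colour : ∀ {u v} → Dec (P u v) → Fin 2
    colour (yes _) = Fin.zero
    colour (no _)  = Fin.suc Fin.zero

    colouring : ∀ u v → E u v → Fin 2
    colouring u v _ = colour (P? u v)

    classP : Part E colouring Fin.zero ⇔ E ∩ P
    classP = to , from
      where
      to : ∀ {u v} → Part E colouring Fin.zero u v → (E ∩ P) u v
      to {u} {v} (e , _) with P? u v
      ... | yes p = e , p
      to (_ , ()) | no _
      from : ∀ {u v} → (E ∩ P) u v → Part E colouring Fin.zero u v
      from {u} {v} (e , p) with P? u v
      ... | yes _ = e , refl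
      ... | no ¬p = contradiction p ¬p

    class¬P : Part E colouring (Fin.suc Fin.zero) ⇔ E ∩ (λ u v → ¬ P u v)
    class¬P = to , from
      where
      to : ∀ {u v} → Part E colouring (Fin.suc Fin.zero) u v → (E ∩ (λ u v → ¬ P u v)) u v
      to {u} {v} (e , _) with P? u v
      to (_ , ()) | yes _
      ... | no ¬p = e , ¬p
      from : ∀ {u v} → (E ∩ (λ u v → ¬ P u v)) u v → Part E colouring (Fin.suc Fin.zero) u v
      from {u} {v} (e , ¬p) with P? u v
      ... | yes p = contradiction p ¬p
      ... | no _  = e , refl

    ferrersClass : ∀ i → IsFerrers (Part E colouring i)
    ferrersClass Fin.zero            = IsFerrers-resp (swap classP) ferrersP
    ferrersClass (Fin.suc Fin.zero)  = IsFerrers-resp (swap class¬P) ferrers¬P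

  distinctRanks-FerrersPartition : {E : BipGraph m n} (r : Fin m → ℕ) (s : Fin n → ℕ) →
    E ⇔ (λ u v → r u ≢ s v) → HasFerrersPartition 2 E
  distinctRanks-FerrersPartition {E} r s (edge⇒≢ , ≢⇒edge) =
    twoFerrersClasses (λ u v → r u <? s v)
      (IsFerrers-resp below (comparison-isFerrers <-strictTotalOrder r s))
      -- in the converse order, r u ⊏ s v means s v < r u
      (IsFerrers-resp above (comparison-isFerrers (Flip.strictTotalOrder <-strictTotalOrder) r s))
    where
    below : (λ u v → r u < s v) ⇔ E ∩ (λ u v → r u < s v)
    below = (λ r<s → ≢⇒edge (<⇒≢ r<s) , r<s) , proj₂

    above : (λ u v → s v < r u) ⇔ E ∩ (λ u v → ¬ r u < s v)
    above = (λ s<r → ≢⇒edge (≢-sym (<⇒≢ s<r)) , <⇒≯ s<r)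
          , (λ (e , r≮s) → ≤∧≢⇒< (≮⇒≥ r≮s) (≢-sym (edge⇒≢ e)))

module _ {k t : ℕ} (h : Fin t → Fin k) where

  rank : ℕ → Fin k → ℕ
  rank default x with any? (λ i → h i ≟ᶠ x)
  ... | yes (i , _) = suc (toℕ i)
  ... | no _        = default

  rank-cases : ∀ default x →
    (∃ λ i → h i ≡ x × rank default x ≡ suc (toℕ i)) ⊎ rank default x ≡ default
  rank-cases default x with any? (λ i → h i ≟ᶠ x)
  ... | yes (i , hi≡x) = inj₁ (i , hi≡x , refl)
  ... | no _           = inj₂ refl

  rank-image : Injective _≡_ _≡_ h → ∀ default i → rank default (h i) ≡ suc (toℕ i)
  rank-image h-inj default i with any? (λ j → h j ≟ᶠ h i)
  ... | yes (j , hj≡hi) = cong (suc ∘ toℕ) (h-inj hj≡hi)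
  ... | no ∄j           = contradiction (i , refl) ∄j

module _ {m n t : ℕ} (f : Fin t → Fin m) (g : Fin t → Fin n) where

  KminusM⇔ranks≢ : Injective _≡_ _≡_ f → Injective _≡_ _≡_ g →
    KminusM f g ⇔ (λ u v → rank f 0 u ≢ rank g (suc t) v)
  KminusM⇔ranks≢ f-inj g-inj = edge⇒ranks≢ , ranks≢⇒edge
    where
    edge⇒ranks≢ : ∀ {u v} → KminusM f g u v → rank f 0 u ≢ rank g (suc t) v
    edge⇒ranks≢ {u} {v} uv∉M ru≡sv with rank-cases f 0 u | rank-cases g (suc t) v
    ... | inj₁ (i , fi≡u , ru≡i+1) | inj₁ (j , gj≡v , sv≡j+1) =
      uv∉M (i , fi≡u , subst (λ l → g l ≡ v) (sym i≡j) gj≡v)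
      where
      i≡j : i ≡ j
      i≡j = toℕ-injective (suc-injective (trans (sym ru≡i+1) (trans ru≡sv sv≡j+1)))
    ... | inj₁ (i , _ , ru≡i+1) | inj₂ sv≡t+1 =
      <⇒≢ (toℕ<n i) (suc-injective (trans (sym ru≡i+1) (trans ru≡sv sv≡t+1)))
    ... | inj₂ ru≡0 | inj₁ (_ , _ , sv≡j+1) = 0≢1+n (trans (sym ru≡0) (trans ru≡sv sv≡j+1))
    ... | inj₂ ru≡0 | inj₂ sv≡t+1           = 0≢1+n (trans (sym ru≡0) (trans ru≡sv sv≡t+1))

    ranks≢⇒edge : ∀ {u v} → rank f 0 u ≢ rank g (suc t) v → KminusM f g u v
    ranks≢⇒edge ru≢sv (i , refl , refl) =
      ru≢sv (trans (rank-image f f-inj 0 i) (sym (rank-image g g-inj (suc t) i)))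

  KminusM-FerrersPartition : Injective _≡_ _≡_ f → Injective _≡_ _≡_ g →
    HasFerrersPartition 2 (KminusM f g)
  KminusM-FerrersPartition f-inj g-inj =
    distinctRanks-FerrersPartition (rank f 0) (rank g (suc t)) (KminusM⇔ranks≢ f-inj g-inj)

  KminusM-isFerrers : t ≤ 1 → IsFerrers (KminusM f g)
  KminusM-isFerrers t≤1 u₁ u₂ v₁ v₂ _ _ u₁≢u₂ _
    with any? (λ i → (f i ≟ᶠ u₁) ×-dec (g i ≟ᶠ v₂))
  ... | no u₁v₂∉M = inj₁ u₁v₂∉M
  ... | yes (i , fi≡u₁ , _) =
    inj₂ λ (j , fj≡u₂ , _) → u₁≢u₂ (trans (sym fi≡u₁) (trans (cong f (Fin≤1-unique t≤1 i j)) fj≡u₂))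

  KminusM-cross : Injective _≡_ _≡_ f → Injective _≡_ _≡_ g →
    ∀ {i j} → i ≢ j → KminusM f g (f i) (g j)
  KminusM-cross f-inj g-inj i≢j (l , fl≡fi , gl≡gj) =
    i≢j (trans (sym (f-inj fl≡fi)) (g-inj gl≡gj))

  KminusM-not-isFerrers : Injective _≡_ _≡_ f → Injective _≡_ _≡_ g →
    ∀ {i j} → i ≢ j → ¬ IsFerrers (KminusM f g)
  KminusM-not-isFerrers f-inj g-inj {i} {j} i≢j ferrers
    with ferrers (f i) (f j) (g j) (g i)
                 (KminusM-cross f-inj g-inj i≢j) (KminusM-cross f-inj g-inj (≢-sym i≢j))
                 (i≢j ∘ f-inj) (≢-sym i≢j ∘ g-inj)
  ... | inj₁ fi-gi∉M = fi-gi∉M (i , refl , refl)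
  ... | inj₂ fj-gj∉M = fj-gj∉M (j , refl , refl)

theorem6p5 : (m n t : ℕ) → 1 ≤ m → 1 ≤ n →
    (f : Fin t → Fin m) → (g : Fin t → Fin n) →
    Injective _≡_ _≡_ f → Injective _≡_ _≡_ g →
    (t ≤ 1 → FpIs (KminusM f g) 1) × (2 ≤ t → FpIs (KminusM f g) 2)
theorem6p5 m n t _ _ f g f-inj g-inj = smallMatching , largeMatching
  where
  smallMatching : t ≤ 1 → FpIs (KminusM f g) 1
  smallMatching t≤1 = isFerrers⇒FpIs1 (KminusM-isFerrers f g t≤1)

  largeMatching : 2 ≤ t → FpIs (KminusM f g) 2
  largeMatching (s≤s (s≤s _)) =
    nonFerrers⇒FpIs2 (KminusM-FerrersPartition f g f-inj g-inj)
      (KminusM-not-isFerrers f g f-inj g-inj {Fin.zero} {Fin.suc Fin.zero} λ ())
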